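{- Let $(A,B)$ be an invertible Jones pair of $n\times n$ matrices with $A$ symmetric. Then the space $\mathcal B=\{\mathcal M(F,G,H) : F\in\mathcal N_A,\ G,H\in\mathcal N_{A,B}\}$ is closed under matrix multiplication and any two of its elements commute, i.e. it is a commutative algebra under matrix multiplication.
   Context: All matrices are complex. $X\circ Y$ is the Schur product; $X^{(-)}$ is the Schur inverse of a matrix with no zero entries. $W$ ($n\times n$) is type-II if $W(W^{(-)})^T=nI$. For a matrix $C$, $X_C(M)=CM$, $\Delta_C(M)=C\circ M$. A Jones pair is a pair $(A,B)$ of $n\times n$ matrices with $X_A$, $\Delta_B$ invertible, $X_A\Delta_BX_A=\Delta_BX_A\Delta_B$ and $X_A\Delta_{B^T}X_A=\Delta_{B^T}X_A\Delta_{B^T}$; it is invertible if moreover $A$ has no zero entry and $B$ is invertible (equivalently $A,B$ type-II). With $e_1,\dots,e_n$ the standard basis, for $P$ invertible and $Q$ without zero entries, $\mathcal N_{P,Q}$ is the set of matrices $M$ such that every $Pe_i\circ Qe_j$ is an eigenvector of $M$, and $\Theta_{P,Q}(M)$ is the matrix with $M(Pe_i\circ Qe_j)=\Theta_{P,Q}(M)_{ij}(Pe_i\circ Qe_j)$. For type-II $P$, $\mathcal N_P:=\mathcal N_{P,P^{(-)}}$, $\Theta_P:=\Theta_{P,P^{(-)}}$. Standing facts for the definitions: $\mathcal N_{A,B}=\mathcal N_{A,B^T}$ is closed under transposition and $\mathcal N_A=\mathcal N_{B^{(-)}}$. Pairing: for $H\in\mathcal N_{A,B}$, the matrix paired with $H$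 is the unique $K$ with $K^T\in\mathcal N_{A,B^T}$ and $\Theta_{A,B}(H)=\Theta_{A,B^T}(K^T)^T$. For $F\in\mathcal N_A$, $G,H\in\mathcal N_{A,B}$, with $K$ paired with $H$, \[ \mathcal M(F,G,H)=\begin{pmatrix} \Theta_A(F)+H & \Theta_A(F)-H & \Theta_{A,B}(G) & \Theta_{A,B}(G)\\ \Theta_A(F)-H & \Theta_A(F)+H & \Theta_{A,B}(G) & \Theta_{A,B}(G)\\ \Theta_{A,B}(G^T)^T & \Theta_{A,B}(G^T)^T & \Theta_{B^{(-)}}(F)+K & \Theta_{B^{(-)}}(F)-K\\ \Theta_{A,B}(G^T)^T & \Theta_{A,B}(G^T)^T & \Theta_{B^{(-)}}(F)-K & \Theta_{B^{(-)}}(F)+K \end{pmatrix}. \] -}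

module Defs where

open import Level using (Level; _⊔_) renaming (suc to lsuc)
open import Algebra.Bundles using (CommutativeRing)
open import Data.Nat using (ℕ; zero; suc)
open import Data.Fin using (Fin)
open import Data.List using (List; []; _∷_)
open import Data.Product using (Σ; ∃; _×_; _,_)
open import Relation.Nullary using (¬_)

-- Scalars.  The paper works over ℂ; agda-stdlib has no ℂ, so we work
-- over an arbitrary algebraically closed field of characteristic 0.

-- Horner evaluation of the MONIC polynomial
--   c₀ + c₁ x + … + c_{k-1} x^{k-1} + x^k   (k = length of the list).
module _ {c ℓ} (R : CommutativeRing c ℓ) where
  open CommutativeRing R
  evalMonic : List Carrier → Carrier → Carrier
  evalMonic []       x = 1#
  evalMonic (a ∷ as) x = a + x * evalMonic as x

  natR : ℕ → Carrier
  natR zero    = 0#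
  natR (suc m) = 1# + natR m

record ACField0 (c ℓ : Level) : Set (lsuc (c ⊔ ℓ)) where
  field
    cring : CommutativeRing c ℓ
  open CommutativeRing cring
  field
    _⁻¹          : Carrier → Carrier
    0≉1          : ¬ (0# ≈ 1#)
    ⁻¹-inverse   : ∀ x → ¬ (x ≈ 0#) → x * (x ⁻¹) ≈ 1#
    char0        : ∀ m → ¬ (natR cring (suc m) ≈ 0#)
    algClosed    : ∀ a as → ∃ λ x → evalMonic cring (a ∷ as) x ≈ 0#
  open CommutativeRing cring public

module Matrices {c ℓ} (𝔽 : ACField0 c ℓ) where
  open ACField0 𝔽

  Mat : ℕ → Set c
  Mat n = Fin n → Fin n → Carrier

  sumFin : ∀ {n} → (Fin n → Carrier) → Carrier
  sumFin {zero}  f = 0#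
  sumFin {suc n} f = f Fin.zero + sumFin (λ i → f (Fin.suc i))

  _≈ᴹ_ : ∀ {n} → Mat n → Mat n → Set ℓ
  X ≈ᴹ Y = ∀ i j → X i j ≈ Y i j

  _·_ : ∀ {n} → Mat n → Mat n → Mat n
  (X · Y) i j = sumFin (λ k → X i k * Y k j)

  _+ᴹ_ : ∀ {n} → Mat n → Mat n → Mat n
  (X +ᴹ Y) i j = X i j + Y i j

  _-ᴹ_ : ∀ {n} → Mat n → Mat n → Mat n
  (X -ᴹ Y) i j = X i j - Y i j

  _∘ˢ_ : ∀ {n} → Mat n → Mat n → Mat n
  (X ∘ˢ Y) i j = X i j * Y i j

  _⁽⁻⁾ : ∀ {n} → Mat n → Mat n
  (X ⁽⁻⁾) i j = (X i j) ⁻¹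

  _ᵀ : ∀ {n} → Mat n → Mat n
  (X ᵀ) i j = X j i

  I : ∀ {n} → Mat n
  I i j with i Data.Fin.≟ j
  ... | Relation.Nullary.yes _ = 1#
  ... | Relation.Nullary.no  _ = 0#

  nI : ∀ n → Mat n
  nI n i j = natR cring n * I i j

  NoZeroEntry : ∀ {n} → Mat n → Set ℓ
  NoZeroEntry X = ∀ i j → ¬ (X i j ≈ 0#)

  Invertible : ∀ {n} → Mat n → Set (c ⊔ ℓ)
  Invertible X = Σ (Mat _) λ Y → ((X · Y) ≈ᴹ I) × ((Y · X) ≈ᴹ I)

  Symmetric : ∀ {n} → Mat n → Set ℓ
  Symmetric X = X ≈ᴹ (X ᵀ)

  TypeII : ∀ {n} → Mat n → Set ℓ
  TypeII {n} W = NoZeroEntry W × ((W · ((W ⁽⁻⁾) ᵀ)) ≈ᴹ nI n)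

  -- Jones pair: X_A, Δ_B invertible and the two braid relations on Mat n
  -- (X_A(M) = A M,  Δ_B(M) = B ∘ M).  X_A is invertible iff A is an
  -- invertible matrix; Δ_B is invertible iff B has no zero entry.
  JonesPair : ∀ {n} → Mat n → Mat n → Set (c ⊔ ℓ)
  JonesPair A B =
    Invertible A × NoZeroEntry B ×
    (∀ M → (A · (B ∘ˢ (A · M))) ≈ᴹ (B ∘ˢ (A · (B ∘ˢ M)))) ×
    (∀ M → (A · ((B ᵀ) ∘ˢ (A · M))) ≈ᴹ ((B ᵀ) ∘ˢ (A · ((B ᵀ) ∘ˢ M))))

  InvertibleJonesPair : ∀ {n} → Mat n → Mat n → Set (c ⊔ ℓ)
  InvertibleJonesPair A B = JonesPair A B × NoZeroEntry A × Invertible B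

  vec : ∀ {n} → Mat n → Mat n → Fin n → Fin n → Fin n → Carrier
  vec P Q i j k = P k i * Q k j

  -- IsΘ P Q M T : every P eᵢ ∘ Q eⱼ is an eigenvector of M, with
  -- eigenvalue T i j.  Hence M ∈ 𝒩_{P,Q} and Θ_{P,Q}(M) = T (for P
  -- invertible, Q without zero entries these vectors are nonzero, so
  -- the eigenvalues, i.e. Θ_{P,Q}(M), are uniquely determined by M).
  IsΘ : ∀ {n} → Mat n → Mat n → Mat n → Mat n → Set ℓ
  IsΘ P Q M T = ∀ i j k →
    sumFin (λ l → M k l * vec P Q i j l) ≈ T i j * vec P Q i j k

  _∈𝒩[_,_] : ∀ {n} → Mat n → Mat n → Mat n → Set (c ⊔ ℓ)
  M ∈𝒩[ P , Q ] = ∀ i j → ∃ λ λᵢⱼ → ∀ k →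
    sumFin (λ l → M k l * vec P Q i j l) ≈ λᵢⱼ * vec P Q i j k

  -- 4n × 4n matrices, written in 4 × 4 block form (block (a,b) is n×n).
  BMat : ℕ → Set c
  BMat n = Fin 4 → Fin 4 → Mat n

  _≈ᴮ_ : ∀ {n} → BMat n → BMat n → Set ℓ
  X ≈ᴮ Y = ∀ a b → X a b ≈ᴹ Y a b

  _·ᴮ_ : ∀ {n} → BMat n → BMat n → BMat n
  (X ·ᴮ Y) a b i j = sumFin (λ c' → sumFin (λ k → X a c' i k * Y c' b k j))

  -- the block matrix 𝓜, from the matrices ΘA(F)=Θ_A(F), ΘB(F)=Θ_{B⁽⁻⁾}(F),
  -- ΘG = Θ_{A,B}(G), ΘGt = Θ_{A,B}(Gᵀ), and H, K.
  blocks : ∀ {n} → (ΘAF ΘBF ΘG ΘGt H K : Mat n) → BMat n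
  blocks ΘAF ΘBF ΘG ΘGt H K = tbl
    where
    r1 r2 r3 r4 : Fin 4 → Mat _
    r1 = λ { Fin.zero → ΘAF +ᴹ H ; (Fin.suc Fin.zero) → ΘAF -ᴹ H ; _ → ΘG }
    r2 = λ { Fin.zero → ΘAF -ᴹ H ; (Fin.suc Fin.zero) → ΘAF +ᴹ H ; _ → ΘG }
    r3 = λ { Fin.zero → ΘGt ᵀ ; (Fin.suc Fin.zero) → ΘGt ᵀ
           ; (Fin.suc (Fin.suc Fin.zero)) → ΘBF +ᴹ K ; _ → ΘBF -ᴹ K }
    r4 = λ { Fin.zero → ΘGt ᵀ ; (Fin.suc Fin.zero) → ΘGt ᵀ
           ; (Fin.suc (Fin.suc Fin.zero)) → ΘBF -ᴹ K ; _ → ΘBF +ᴹ K }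
    tbl : BMat _
    tbl Fin.zero = r1
    tbl (Fin.suc Fin.zero) = r2
    tbl (Fin.suc (Fin.suc Fin.zero)) = r3
    tbl (Fin.suc (Fin.suc (Fin.suc Fin.zero))) = r4

  -- Each Θ-value is given together with the proof that it is that
  -- Θ-value (these are uniquely determined, see IsΘ).  K is the matrix
  -- paired with H: Kᵀ ∈ 𝒩_{A,Bᵀ} and Θ_{A,B}(H) = Θ_{A,Bᵀ}(Kᵀ)ᵀ.
  record 𝓜-data {n} (A B : Mat n) : Set (c ⊔ ℓ) where
    field
      F G H K ΘAF ΘBF ΘG ΘGt ΘH : Mat n
      F∈𝒩A    : IsΘ A (A ⁽⁻⁾) F ΘAF
      F∈𝒩B⁻   : IsΘ (B ⁽⁻⁾) ((B ⁽⁻⁾) ⁽⁻⁾) F ΘBF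
      G∈𝒩AB   : IsΘ A B G ΘG
      Gᵀ∈𝒩AB  : IsΘ A B (G ᵀ) ΘGt
      H∈𝒩AB   : IsΘ A B H ΘH
      K-paired : IsΘ A (B ᵀ) (K ᵀ) (ΘH ᵀ)

  open 𝓜-data public

  𝓜 : ∀ {n} {A B : Mat n} → 𝓜-data A B → BMat n
  𝓜 d = blocks (ΘAF d) (ΘBF d) (ΘG d) (ΘGt d) (H d) (K d)

  _∈𝓑[_,_] : ∀ {n} → BMat n → Mat n → Mat n → Set (c ⊔ ℓ)
  X ∈𝓑[ A , B ] = Σ (𝓜-data A B) λ d → X ≈ᴮ 𝓜 d

{-# OPTIONS --safe #-}
module Submission where

-- For an invertible Jones pair the braid relations say that A ∈ 𝒩_{A,B} with
-- Θ_{A,B}(A) = B, and likewise for Bᵀ; with A invertible this forces B (in both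
-- orientations) and, A being symmetric, A to be type-II.  For type-II Q the exchange
-- lemma turns Schur products into matrix products of Θ-values:
-- Θ_{P,R}(n M ∘ M′) = Θ_{P,Q}(M) Θ_{Q⁽⁻⁾,R}(M′).  The block pattern of 𝓜 is closed under
-- multiplication, and by the exchange lemma the blocks of 𝓜(F,G,H) 𝓜(F′,G′,H′) are the
-- Θ-values of 2n (F ∘ F′ + G ∘ G′), 2n (F ∘ G′ + G ∘ F′) and 2 H H′, so 𝓑 is closed.
-- Exchanging the two factors changes these data only up to commutativity of the Schur
-- product, and Θ-values and matrices of 𝒩 determine each other, so 𝓑 is commutative.

open import Level using (0ℓ)
open import Defs
open import Algebra.Bundles using (CommutativeRing; RawRing)
open import Data.Nat as ℕ using (ℕ; zero; suc; _∸_)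
open import Data.Product using (_×_; _,_)
open import Data.Fin as Fin using (Fin)
open import Data.Fin.Patterns using (0F; 1F; 2F; 3F)
open import Data.Empty using (⊥-elim)
open import Function using (flip)
open import Data.Fin.Properties using (punchInᵢ≢i)
open import Data.Product.Properties using (≡-dec)
open import Data.Maybe using (Maybe; just; nothing)
open import Relation.Nullary using (¬_; yes; no)
open import Relation.Binary.PropositionalEquality as ≡ using (_≡_; _≢_)

private
  ℕ² : Set
  ℕ² = ℕ × ℕ

-- The library's ring solver needs a coefficient ring with decidable equality in which
-- normal forms are unique; pairs (p , q) of naturals, kept with min p q = 0, stand for
-- the integers p − q.
module IntegerCoefficientSolver {c ℓ} (R : CommutativeRing c ℓ) where
  open CommutativeRing R
  open import Algebra.Properties.Semiring.Mult semiring as Mult using (×-homo-+; ×1-homo-*)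
  open import Algebra.Properties.Ring ring using (-‿distribˡ-*; -‿distribʳ-*)
  open import Algebra.Properties.AbelianGroup +-abelianGroup using (⁻¹-∙-comm; ⁻¹-anti-homo‿-)
  open import Algebra.Properties.Group +-group using (ε⁻¹≈ε)
  open import Algebra.Properties.CommutativeSemigroup +-commutativeSemigroup using (interchange)
  open import Algebra.Solver.Ring.AlmostCommutativeRing
    using (fromCommutativeRing; _-Raw-AlmostCommutative⟶_)
  open import Relation.Binary.Reasoning.Setoid setoid

  private
    reduce : ℕ² → ℕ²
    reduce (p , q) = p ∸ q , q ∸ p

    ℤ-rawRing : RawRing 0ℓ 0ℓ
    ℤ-rawRing = record
      { Carrier = ℕ²
      ; _≈_     = _≡_
      ; _+_     = λ { (p , q) (r , s) → reduce (p ℕ.+ r , q ℕ.+ s) }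
      ; _*_     = λ { (p , q) (r , s) → reduce (p ℕ.* r ℕ.+ q ℕ.* s , p ℕ.* s ℕ.+ q ℕ.* r) }
      ; -_      = λ { (p , q) → q , p }
      ; 0#      = 0 , 0
      ; 1#      = 1 , 0
      }

    ι : ℕ → Carrier
    ι p = p Mult.× 1#

    ⟦_⟧ : ℕ² → Carrier
    ⟦ p , q ⟧ = ι p - ι q

    -‿interchange : ∀ x y u v → (x + y) - (u + v) ≈ (x - u) + (y - v)
    -‿interchange x y u v = trans (+-congˡ (sym (⁻¹-∙-comm u v))) (interchange x y (- u) (- v))

    -‿*-‿ : ∀ x y z w → (x * z + y * w) - (x * w + y * z) ≈ (x - y) * (z - w)
    -‿*-‿ x y z w = begin
      (x * z + y * w) - (x * w + y * z)  ≈⟨ -‿interchange _ _ _ _ ⟩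
      (x * z - x * w) + (y * w - y * z)  ≈⟨ +-congˡ (⁻¹-anti-homo‿- (y * z) (y * w)) ⟨
      (x * z - x * w) - (y * z - y * w)  ≈⟨ +-cong (*-distribˡ-‿ x) (-‿cong (*-distribˡ-‿ y)) ⟨
      x * (z - w) - y * (z - w)          ≈⟨ +-congˡ (-‿distribˡ-* y (z - w)) ⟩
      x * (z - w) + - y * (z - w)        ≈⟨ distribʳ (z - w) x (- y) ⟨
      (x - y) * (z - w)                  ∎
      where
      *-distribˡ-‿ : ∀ a → a * (z - w) ≈ a * z - a * w
      *-distribˡ-‿ a = trans (distribˡ a z (- w)) (+-congˡ (sym (-‿distribʳ-* a w)))

    ⟦reduce⟧ : ∀ p q → ⟦ reduce (p , q) ⟧ ≈ ⟦ p , q ⟧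
    ⟦reduce⟧ zero    zero    = refl
    ⟦reduce⟧ zero    (suc q) = refl
    ⟦reduce⟧ (suc p) zero    = refl
    ⟦reduce⟧ (suc p) (suc q) = begin
      ⟦ reduce (p , q) ⟧           ≈⟨ ⟦reduce⟧ p q ⟩
      ι p - ι q                    ≈⟨ +-identityˡ _ ⟨
      0# + (ι p - ι q)             ≈⟨ +-congʳ (-‿inverseʳ 1#) ⟨
      (1# - 1#) + (ι p - ι q)      ≈⟨ -‿interchange 1# (ι p) 1# (ι q) ⟨
      (1# + ι p) - (1# + ι q)      ∎

    homomorphism : ℤ-rawRing -Raw-AlmostCommutative⟶ fromCommutativeRing R
    homomorphism = record
      { ⟦_⟧    = ⟦_⟧
      ; +-homo = λ { (p , q) (r , s) → begin
          ⟦ reduce (p ℕ.+ r , q ℕ.+ s) ⟧   ≈⟨ ⟦reduce⟧ (p ℕ.+ r) (q ℕ.+ s) ⟩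
          ι (p ℕ.+ r) - ι (q ℕ.+ s)        ≈⟨ +-cong (×-homo-+ 1# p r) (-‿cong (×-homo-+ 1# q s)) ⟩
          (ι p + ι r) - (ι q + ι s)        ≈⟨ -‿interchange _ _ _ _ ⟩
          ⟦ p , q ⟧ + ⟦ r , s ⟧            ∎ }
      ; *-homo = λ { (p , q) (r , s) → begin
          ⟦ reduce (p ℕ.* r ℕ.+ q ℕ.* s , p ℕ.* s ℕ.+ q ℕ.* r) ⟧
            ≈⟨ ⟦reduce⟧ (p ℕ.* r ℕ.+ q ℕ.* s) (p ℕ.* s ℕ.+ q ℕ.* r) ⟩
          ι (p ℕ.* r ℕ.+ q ℕ.* s) - ι (p ℕ.* s ℕ.+ q ℕ.* r)
            ≈⟨ +-cong (ι-+-* p r q s) (-‿cong (ι-+-* p s q r)) ⟩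
          (ι p * ι r + ι q * ι s) - (ι p * ι s + ι q * ι r)
            ≈⟨ -‿*-‿ _ _ _ _ ⟩
          ⟦ p , q ⟧ * ⟦ r , s ⟧ ∎ }
      ; -‿homo = λ { (p , q) → sym (⁻¹-anti-homo‿- (ι p) (ι q)) }
      ; 0-homo = -‿inverseʳ 0#
      ; 1-homo = trans (+-cong (+-identityʳ 1#) ε⁻¹≈ε) (+-identityʳ 1#)
      }
      where
      ι-+-* : ∀ p r q s → ι (p ℕ.* r ℕ.+ q ℕ.* s) ≈ ι p * ι r + ι q * ι s
      ι-+-* p r q s = trans (×-homo-+ 1# (p ℕ.* r) (q ℕ.* s)) (+-cong (×1-homo-* p r) (×1-homo-* q s))

    equal? : ∀ a b → Maybe (⟦ a ⟧ ≈ ⟦ b ⟧)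
    equal? a b with ≡-dec ℕ._≟_ ℕ._≟_ a b
    ... | yes ≡.refl = just refl
    ... | no _       = nothing

  open import Algebra.Solver.Ring ℤ-rawRing (fromCommutativeRing R) homomorphism equal?
    public using (solve; _:+_; _:*_; _:-_; _:=_)


module JonesPairAlgebra {c ℓ} (𝔽 : ACField0 c ℓ) where
  open ACField0 𝔽
  open Matrices 𝔽
  open IntegerCoefficientSolver cring using (solve; _:+_; _:*_; _:-_; _:=_)
  open import Algebra.Properties.Semiring.Sum semiring
    using (sum; sum-cong-≋; sum-replicate-zero; sum-remove; ∑-distrib-+; ∑-comm;
           *-distribˡ-sum; *-distribʳ-sum)
  open import Algebra.Properties.Ring ring using (-1*x≈-x)
  open import Algebra.Properties.CommutativeSemigroup *-commutativeSemigroup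
    using (x∙yz≈y∙xz; x∙yz≈z∙yx; xy∙z≈y∙xz)
  open import Relation.Binary.Reasoning.Setoid setoid

  invertible⇒≉0 : ∀ {x y} → x * y ≈ 1# → ¬ x ≈ 0#
  invertible⇒≉0 {x} {y} xy≈1 x≈0 = 0≉1 (begin
    0#      ≈⟨ zeroˡ y ⟨
    0# * y  ≈⟨ *-congʳ x≈0 ⟨
    x * y   ≈⟨ xy≈1 ⟩
    1#      ∎)

  ⁻¹-inverseˡ : ∀ {x} → ¬ x ≈ 0# → x ⁻¹ * x ≈ 1#
  ⁻¹-inverseˡ {x} x≉0 = trans (*-comm _ _) (⁻¹-inverse x x≉0)

  *-cancelˡ : ∀ {x y z} → ¬ x ≈ 0# → x * y ≈ x * z → y ≈ z
  *-cancelˡ {x} {y} {z} x≉0 xy≈xz = begin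
    y                ≈⟨ *-identityˡ y ⟨
    1# * y           ≈⟨ *-congʳ (⁻¹-inverseˡ x≉0) ⟨
    (x ⁻¹ * x) * y   ≈⟨ *-assoc _ _ _ ⟩
    x ⁻¹ * (x * y)   ≈⟨ *-congˡ xy≈xz ⟩
    x ⁻¹ * (x * z)   ≈⟨ *-assoc _ _ _ ⟨
    (x ⁻¹ * x) * z   ≈⟨ *-congʳ (⁻¹-inverseˡ x≉0) ⟩
    1# * z           ≈⟨ *-identityˡ z ⟩
    z                ∎

  *-cancelʳ : ∀ {x y z} → ¬ x ≈ 0# → y * x ≈ z * x → y ≈ z
  *-cancelʳ x≉0 yx≈zx = *-cancelˡ x≉0 (trans (*-comm _ _) (trans yx≈zx (*-comm _ _)))

  ⁻¹-unique : ∀ {x y} → x * y ≈ 1# → y ≈ x ⁻¹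
  ⁻¹-unique {x} xy≈1 = *-cancelˡ x≉0 (trans xy≈1 (sym (⁻¹-inverse x x≉0)))
    where
    x≉0 : ¬ x ≈ 0#
    x≉0 = invertible⇒≉0 xy≈1

  *-≉0 : ∀ {x y} → ¬ x ≈ 0# → ¬ y ≈ 0# → ¬ x * y ≈ 0#
  *-≉0 {x} x≉0 y≉0 xy≈0 = y≉0 (*-cancelˡ x≉0 (trans xy≈0 (sym (zeroʳ x))))

  *-identityʳ′ : ∀ {a} x → a ≈ 1# → x * a ≈ x
  *-identityʳ′ x a≈1 = trans (*-congˡ a≈1) (*-identityʳ x)

  sumFin≈sum : ∀ {n} (f : Fin n → Carrier) → sumFin f ≈ sum f
  sumFin≈sum {zero}  f = refl
  sumFin≈sum {suc n} f = +-congˡ (sumFin≈sum (λ k → f (Fin.suc k)))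

  Σ-comm : ∀ {m n} (f : Fin m → Fin n → Carrier) →
    sumFin (λ i → sumFin (f i)) ≈ sumFin (λ j → sumFin (λ i → f i j))
  Σ-comm f = trans (≈sum² f) (trans (∑-comm f) (sym (≈sum² (flip f))))
    where
    ≈sum² : ∀ {m n} (g : Fin m → Fin n → Carrier) →
      sumFin (λ i → sumFin (g i)) ≈ sum (λ i → sum (g i))
    ≈sum² g = trans (sumFin≈sum (λ i → sumFin (g i))) (sum-cong-≋ (λ i → sumFin≈sum (g i)))

  Σ-1 : ∀ {n} → sumFin {n} (λ _ → 1#) ≈ natR cring n
  Σ-1 {zero}  = refl
  Σ-1 {suc n} = +-congˡ (Σ-1 {n})

  I-diag : ∀ {n} (i : Fin n) → I i i ≈ 1#
  I-diag i with i Fin.≟ i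
  ... | yes _   = refl
  ... | no i≢i = ⊥-elim (i≢i ≡.refl)

  I-off : ∀ {n} {i j : Fin n} → i ≢ j → I i j ≈ 0#
  I-off {i = i} {j} i≢j with i Fin.≟ j
  ... | yes i≡j = ⊥-elim (i≢j i≡j)
  ... | no _    = refl

  I-sym : ∀ {n} (i j : Fin n) → I i j ≈ I j i
  I-sym i j with i Fin.≟ j
  ... | yes ≡.refl = sym (I-diag i)
  ... | no i≢j     = sym (I-off (λ j≡i → i≢j (≡.sym j≡i)))

  Σ-δ : ∀ {n} (f : Fin n → Carrier) j → sumFin (λ k → f k * I k j) ≈ f j
  Σ-δ {suc n} f j = begin
    sumFin (λ k → f k * I k j)
      ≈⟨ sumFin≈sum (λ k → f k * I k j) ⟩
    sum (λ k → f k * I k j)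
      ≈⟨ sum-remove {i = j} (λ k → f k * I k j) ⟩
    f j * I j j + sum (λ k → f (Fin.punchIn j k) * I (Fin.punchIn j k) j)
      ≈⟨ +-cong (*-identityʳ′ (f j) (I-diag j)) (trans (sum-cong-≋ off-diagonal) (sum-replicate-zero n)) ⟩
    f j + 0#
      ≈⟨ +-identityʳ (f j) ⟩
    f j ∎
    where
    off-diagonal : ∀ k → f (Fin.punchIn j k) * I (Fin.punchIn j k) j ≈ 0#
    off-diagonal k = trans (*-congˡ (I-off (punchInᵢ≢i j k))) (zeroʳ _)

  -- The size is a module parameter because sumFin is not injective: an implicit size
  -- could not be inferred from a goal.
  module Σ-Properties {n : ℕ} where

    Σ-cong : ∀ {f g : Fin n → Carrier} → (∀ k → f k ≈ g k) → sumFin f ≈ sumFin g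
    Σ-cong {f} {g} f≈g = trans (sumFin≈sum f) (trans (sum-cong-≋ f≈g) (sym (sumFin≈sum g)))

    Σ-+ : ∀ (f g : Fin n → Carrier) → sumFin (λ k → f k + g k) ≈ sumFin f + sumFin g
    Σ-+ f g = trans (sumFin≈sum (λ k → f k + g k))
      (trans (∑-distrib-+ f g) (sym (+-cong (sumFin≈sum f) (sumFin≈sum g))))

    Σ-*ˡ : ∀ x (f : Fin n → Carrier) → sumFin (λ k → x * f k) ≈ x * sumFin f
    Σ-*ˡ x f = trans (sumFin≈sum (λ k → x * f k))
      (trans (sym (*-distribˡ-sum x f)) (*-congˡ (sym (sumFin≈sum f))))

    Σ-*ʳ : ∀ x (f : Fin n → Carrier) → sumFin (λ k → f k * x) ≈ sumFin f * x
    Σ-*ʳ x f = trans (sumFin≈sum (λ k → f k * x))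
      (trans (sym (*-distribʳ-sum x f)) (*-congʳ (sym (sumFin≈sum f))))

    Σ-neg : ∀ (f : Fin n → Carrier) → sumFin (λ k → - f k) ≈ - sumFin f
    Σ-neg f = trans (Σ-cong (λ k → sym (-1*x≈-x (f k)))) (trans (Σ-*ˡ (- 1#) f) (-1*x≈-x _))

    Σ-swap : ∀ (f : Fin n → Fin n → Carrier) →
      sumFin (λ i → sumFin (f i)) ≈ sumFin (λ j → sumFin (λ i → f i j))
    Σ-swap = Σ-comm

    Σ-*-Σ : ∀ (f g : Fin n → Carrier) → sumFin f * sumFin g ≈ sumFin (λ i → sumFin (λ j → f i * g j))
    Σ-*-Σ f g = trans (sym (Σ-*ʳ _ f)) (Σ-cong (λ i → sym (Σ-*ˡ (f i) g)))

    Σ-δ′ : ∀ (f : Fin n → Carrier) j → sumFin (λ k → f k * I j k) ≈ f j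
    Σ-δ′ f j = trans (Σ-cong (λ k → *-congˡ (I-sym j k))) (Σ-δ f j)

    Σ-nI : ∀ (f : Fin n → Carrier) j → sumFin (λ k → f k * nI n k j) ≈ natR cring n * f j
    Σ-nI f j = trans (Σ-cong (λ k → x∙yz≈y∙xz (f k) _ _)) (trans (Σ-*ˡ _ _) (*-congˡ (Σ-δ f j)))

    Σ-nI′ : ∀ (f : Fin n → Carrier) j → sumFin (λ k → f k * nI n j k) ≈ natR cring n * f j
    Σ-nI′ f j = trans (Σ-cong (λ k → *-congˡ (*-congˡ (I-sym j k)))) (Σ-nI f j)

  ≈ᴹ-refl : ∀ {n} {X : Mat n} → X ≈ᴹ X
  ≈ᴹ-refl _ _ = refl

  _⊙_ : ∀ {n} → Carrier → Mat n → Mat n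
  (x ⊙ X) i j = x * X i j

  double : ∀ {n} → Mat n → Mat n
  double X = X +ᴹ X

  double-cong : ∀ {n} {X Y : Mat n} → X ≈ᴹ Y → double X ≈ᴹ double Y
  double-cong X≈Y i j = +-cong (X≈Y i j) (X≈Y i j)

  SchurInverses : ∀ {n} → Mat n → Mat n → Set ℓ
  SchurInverses Q Q′ = ∀ i j → Q i j * Q′ i j ≈ 1#

  module _ {n : ℕ} where
    open Σ-Properties {n}

    private
      N : Carrier
      N = natR cring n

    -- The block algebra

    blocks-cong : ∀ {a b g γ h κ a′ b′ g′ γ′ h′ κ′ : Mat n} →
      a ≈ᴹ a′ → b ≈ᴹ b′ → g ≈ᴹ g′ → γ ≈ᴹ γ′ → h ≈ᴹ h′ → κ ≈ᴹ κ′ →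
      blocks a b g γ h κ ≈ᴮ blocks a′ b′ g′ γ′ h′ κ′
    blocks-cong a≈ b≈ g≈ γ≈ h≈ κ≈ 0F 0F i j = +-cong (a≈ i j) (h≈ i j)
    blocks-cong a≈ b≈ g≈ γ≈ h≈ κ≈ 0F 1F i j = +-cong (a≈ i j) (-‿cong (h≈ i j))
    blocks-cong a≈ b≈ g≈ γ≈ h≈ κ≈ 0F 2F i j = g≈ i j
    blocks-cong a≈ b≈ g≈ γ≈ h≈ κ≈ 0F 3F i j = g≈ i j
    blocks-cong a≈ b≈ g≈ γ≈ h≈ κ≈ 1F 0F i j = +-cong (a≈ i j) (-‿cong (h≈ i j))
    blocks-cong a≈ b≈ g≈ γ≈ h≈ κ≈ 1F 1F i j = +-cong (a≈ i j) (h≈ i j)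
    blocks-cong a≈ b≈ g≈ γ≈ h≈ κ≈ 1F 2F i j = g≈ i j
    blocks-cong a≈ b≈ g≈ γ≈ h≈ κ≈ 1F 3F i j = g≈ i j
    blocks-cong a≈ b≈ g≈ γ≈ h≈ κ≈ 2F 0F i j = γ≈ j i
    blocks-cong a≈ b≈ g≈ γ≈ h≈ κ≈ 2F 1F i j = γ≈ j i
    blocks-cong a≈ b≈ g≈ γ≈ h≈ κ≈ 2F 2F i j = +-cong (b≈ i j) (κ≈ i j)
    blocks-cong a≈ b≈ g≈ γ≈ h≈ κ≈ 2F 3F i j = +-cong (b≈ i j) (-‿cong (κ≈ i j))
    blocks-cong a≈ b≈ g≈ γ≈ h≈ κ≈ 3F 0F i j = γ≈ j i
    blocks-cong a≈ b≈ g≈ γ≈ h≈ κ≈ 3F 1F i j = γ≈ j i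
    blocks-cong a≈ b≈ g≈ γ≈ h≈ κ≈ 3F 2F i j = +-cong (b≈ i j) (-‿cong (κ≈ i j))
    blocks-cong a≈ b≈ g≈ γ≈ h≈ κ≈ 3F 3F i j = +-cong (b≈ i j) (κ≈ i j)

    ·ᴮ-cong : ∀ {X X′ Y Y′ : BMat n} → X ≈ᴮ X′ → Y ≈ᴮ Y′ → (X ·ᴮ Y) ≈ᴮ (X′ ·ᴮ Y′)
    ·ᴮ-cong {X} {X′} {Y} {Y′} X≈ Y≈ p q i j =
      trans (sumFin≈sum (λ r → sumFin (λ k → X p r i k * Y r q k j)))
      (trans (sum-cong-≋ (λ r → Σ-cong (λ k → *-cong (X≈ p r i k) (Y≈ r q k j))))
             (sym (sumFin≈sum (λ r → sumFin (λ k → X′ p r i k * Y′ r q k j)))))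


    private
      Σ₄ : (Fin 4 → Carrier) → Carrier
      Σ₄ t = t 0F + (t 1F + (t 2F + t 3F))

    module _ {a b g γ h κ a′ b′ g′ γ′ h′ κ′ : Mat n} where
      private
        X Y : BMat n
        X = blocks a b g γ h κ
        Y = blocks a′ b′ g′ γ′ h′ κ′

        entry : ∀ p q {i j} {u : Fin n → Carrier} →
          (∀ k → Σ₄ (λ r → X p r i k * Y r q k j) ≈ u k) → (X ·ᴮ Y) p q i j ≈ sumFin u
        entry p q {i} {j} t≈u = trans (Σ-comm (λ r k → X p r i k * Y r q k j))
          (Σ-cong (λ k → trans (+-congˡ (+-congˡ (+-congˡ (+-identityʳ _)))) (t≈u k)))

        entry₀ : ∀ p q {i j} {f g : Fin n → Carrier} →
          (∀ k → Σ₄ (λ r → X p r i k * Y r q k j) ≈ (f k + g k) + (f k + g k)) →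
          (X ·ᴮ Y) p q i j ≈ (sumFin f + sumFin g) + (sumFin f + sumFin g)
        entry₀ p q t≈ = trans (entry p q t≈) (trans (Σ-+ _ _) (+-cong (Σ-+ _ _) (Σ-+ _ _)))

        entry₊ : ∀ p q {i j} {f g e : Fin n → Carrier} →
          (∀ k → Σ₄ (λ r → X p r i k * Y r q k j) ≈ ((f k + g k) + (f k + g k)) + (e k + e k)) →
          (X ·ᴮ Y) p q i j ≈ ((sumFin f + sumFin g) + (sumFin f + sumFin g)) + (sumFin e + sumFin e)
        entry₊ p q t≈ = trans (entry p q t≈)
          (trans (Σ-+ _ _) (+-cong (trans (Σ-+ _ _) (+-cong (Σ-+ _ _) (Σ-+ _ _))) (Σ-+ _ _)))

        entry₋ : ∀ p q {i j} {f g e : Fin n → Carrier} →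
          (∀ k → Σ₄ (λ r → X p r i k * Y r q k j) ≈ ((f k + g k) + (f k + g k)) - (e k + e k)) →
          (X ·ᴮ Y) p q i j ≈ ((sumFin f + sumFin g) + (sumFin f + sumFin g)) - (sumFin e + sumFin e)
        entry₋ p q t≈ = trans (entry p q t≈)
          (trans (Σ-+ _ _) (+-cong (trans (Σ-+ _ _) (+-cong (Σ-+ _ _) (Σ-+ _ _)))
                                   (trans (Σ-neg _) (-‿cong (Σ-+ _ _)))))

      -- blocks a b g γ h κ = [[a , g] , [γᵀ , b]] ⊗ E + diag(h , κ) ⊗ D, where ⊗ replaces
      -- each block x by x E or x D with E = [[1 , 1] , [1 , 1]] and D = [[1 , -1] , [-1 , 1]];
      -- the product rule follows from E² = 2E, D² = 2D and ED = DE = 0.  In each clause x, y, z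
      -- (x′, y′, z′) are the entries at k of the E-part, the D-part and the off-diagonal block
      -- of the row of the left (column of the right) factor.
      blocks-· : (blocks a b g γ h κ ·ᴮ blocks a′ b′ g′ γ′ h′ κ′) ≈ᴮ
        blocks (double ((a · a′) +ᴹ (g · (γ′ ᵀ)))) (double ((b · b′) +ᴹ ((γ ᵀ) · g′)))
               (double ((a · g′) +ᴹ (g · b′)))      (double ((γ′ · (b ᵀ)) +ᴹ ((a′ ᵀ) · γ)))
               (double (h · h′))                   (double (κ · κ′))
      blocks-· 0F 0F i j = entry₊ 0F 0F λ k → solve 6
        (λ x y z x′ y′ z′ → (x :+ y) :* (x′ :+ y′) :+ ((x :- y) :* (x′ :- y′) :+ (z :* z′ :+ z :* z′))
                         := ((x :* x′ :+ z :* z′) :+ (x :* x′ :+ z :* z′)) :+ (y :* y′ :+ y :* y′))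
        refl (a i k) (h i k) (g i k) (a′ k j) (h′ k j) (γ′ j k)
      blocks-· 0F 1F i j = entry₋ 0F 1F λ k → solve 6
        (λ x y z x′ y′ z′ → (x :+ y) :* (x′ :- y′) :+ ((x :- y) :* (x′ :+ y′) :+ (z :* z′ :+ z :* z′))
                         := ((x :* x′ :+ z :* z′) :+ (x :* x′ :+ z :* z′)) :- (y :* y′ :+ y :* y′))
        refl (a i k) (h i k) (g i k) (a′ k j) (h′ k j) (γ′ j k)
      blocks-· 0F 2F i j = entry₀ 0F 2F λ k → solve 6
        (λ x y z x′ y′ z′ → (x :+ y) :* z′ :+ ((x :- y) :* z′ :+ (z :* (x′ :+ y′) :+ z :* (x′ :- y′)))
                         := (x :* z′ :+ z :* x′) :+ (x :* z′ :+ z :* x′))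
        refl (a i k) (h i k) (g i k) (b′ k j) (κ′ k j) (g′ k j)
      blocks-· 0F 3F i j = entry₀ 0F 3F λ k → solve 6
        (λ x y z x′ y′ z′ → (x :+ y) :* z′ :+ ((x :- y) :* z′ :+ (z :* (x′ :- y′) :+ z :* (x′ :+ y′)))
                         := (x :* z′ :+ z :* x′) :+ (x :* z′ :+ z :* x′))
        refl (a i k) (h i k) (g i k) (b′ k j) (κ′ k j) (g′ k j)
      blocks-· 1F 0F i j = entry₋ 1F 0F λ k → solve 6
        (λ x y z x′ y′ z′ → (x :- y) :* (x′ :+ y′) :+ ((x :+ y) :* (x′ :- y′) :+ (z :* z′ :+ z :* z′))
                         := ((x :* x′ :+ z :* z′) :+ (x :* x′ :+ z :* z′)) :- (y :* y′ :+ y :* y′))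
        refl (a i k) (h i k) (g i k) (a′ k j) (h′ k j) (γ′ j k)
      blocks-· 1F 1F i j = entry₊ 1F 1F λ k → solve 6
        (λ x y z x′ y′ z′ → (x :- y) :* (x′ :- y′) :+ ((x :+ y) :* (x′ :+ y′) :+ (z :* z′ :+ z :* z′))
                         := ((x :* x′ :+ z :* z′) :+ (x :* x′ :+ z :* z′)) :+ (y :* y′ :+ y :* y′))
        refl (a i k) (h i k) (g i k) (a′ k j) (h′ k j) (γ′ j k)
      blocks-· 1F 2F i j = entry₀ 1F 2F λ k → solve 6
        (λ x y z x′ y′ z′ → (x :- y) :* z′ :+ ((x :+ y) :* z′ :+ (z :* (x′ :+ y′) :+ z :* (x′ :- y′)))
                         := (x :* z′ :+ z :* x′) :+ (x :* z′ :+ z :* x′))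
        refl (a i k) (h i k) (g i k) (b′ k j) (κ′ k j) (g′ k j)
      blocks-· 1F 3F i j = entry₀ 1F 3F λ k → solve 6
        (λ x y z x′ y′ z′ → (x :- y) :* z′ :+ ((x :+ y) :* z′ :+ (z :* (x′ :- y′) :+ z :* (x′ :+ y′)))
                         := (x :* z′ :+ z :* x′) :+ (x :* z′ :+ z :* x′))
        refl (a i k) (h i k) (g i k) (b′ k j) (κ′ k j) (g′ k j)
      blocks-· 2F 0F i j = entry₀ 2F 0F λ k → solve 6
        (λ x y z x′ y′ z′ → z :* (x′ :+ y′) :+ (z :* (x′ :- y′) :+ ((x :+ y) :* z′ :+ (x :- y) :* z′))
                         := (z′ :* x :+ x′ :* z) :+ (z′ :* x :+ x′ :* z))
        refl (b i k) (κ i k) (γ k i) (a′ k j) (h′ k j) (γ′ j k)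
      blocks-· 2F 1F i j = entry₀ 2F 1F λ k → solve 6
        (λ x y z x′ y′ z′ → z :* (x′ :- y′) :+ (z :* (x′ :+ y′) :+ ((x :+ y) :* z′ :+ (x :- y) :* z′))
                         := (z′ :* x :+ x′ :* z) :+ (z′ :* x :+ x′ :* z))
        refl (b i k) (κ i k) (γ k i) (a′ k j) (h′ k j) (γ′ j k)
      blocks-· 2F 2F i j = entry₊ 2F 2F λ k → solve 6
        (λ x y z x′ y′ z′ → z :* z′ :+ (z :* z′ :+ ((x :+ y) :* (x′ :+ y′) :+ (x :- y) :* (x′ :- y′)))
                         := ((x :* x′ :+ z :* z′) :+ (x :* x′ :+ z :* z′)) :+ (y :* y′ :+ y :* y′))
        refl (b i k) (κ i k) (γ k i) (b′ k j) (κ′ k j) (g′ k j)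
      blocks-· 2F 3F i j = entry₋ 2F 3F λ k → solve 6
        (λ x y z x′ y′ z′ → z :* z′ :+ (z :* z′ :+ ((x :+ y) :* (x′ :- y′) :+ (x :- y) :* (x′ :+ y′)))
                         := ((x :* x′ :+ z :* z′) :+ (x :* x′ :+ z :* z′)) :- (y :* y′ :+ y :* y′))
        refl (b i k) (κ i k) (γ k i) (b′ k j) (κ′ k j) (g′ k j)
      blocks-· 3F 0F i j = entry₀ 3F 0F λ k → solve 6
        (λ x y z x′ y′ z′ → z :* (x′ :+ y′) :+ (z :* (x′ :- y′) :+ ((x :- y) :* z′ :+ (x :+ y) :* z′))
                         := (z′ :* x :+ x′ :* z) :+ (z′ :* x :+ x′ :* z))
        refl (b i k) (κ i k) (γ k i) (a′ k j) (h′ k j) (γ′ j k)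
      blocks-· 3F 1F i j = entry₀ 3F 1F λ k → solve 6
        (λ x y z x′ y′ z′ → z :* (x′ :- y′) :+ (z :* (x′ :+ y′) :+ ((x :- y) :* z′ :+ (x :+ y) :* z′))
                         := (z′ :* x :+ x′ :* z) :+ (z′ :* x :+ x′ :* z))
        refl (b i k) (κ i k) (γ k i) (a′ k j) (h′ k j) (γ′ j k)
      blocks-· 3F 2F i j = entry₋ 3F 2F λ k → solve 6
        (λ x y z x′ y′ z′ → z :* z′ :+ (z :* z′ :+ ((x :- y) :* (x′ :+ y′) :+ (x :+ y) :* (x′ :- y′)))
                         := ((x :* x′ :+ z :* z′) :+ (x :* x′ :+ z :* z′)) :- (y :* y′ :+ y :* y′))
        refl (b i k) (κ i k) (γ k i) (b′ k j) (κ′ k j) (g′ k j)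
      blocks-· 3F 3F i j = entry₊ 3F 3F λ k → solve 6
        (λ x y z x′ y′ z′ → z :* z′ :+ (z :* z′ :+ ((x :- y) :* (x′ :- y′) :+ (x :+ y) :* (x′ :+ y′)))
                         := ((x :* x′ :+ z :* z′) :+ (x :* x′ :+ z :* z′)) :+ (y :* y′ :+ y :* y′))
        refl (b i k) (κ i k) (γ k i) (b′ k j) (κ′ k j) (g′ k j)

    -- The Θ-calculus

    IsΘ-cong : ∀ {P P′ Q Q′ M M′ T T′ : Mat n} → P ≈ᴹ P′ → Q ≈ᴹ Q′ → M ≈ᴹ M′ → T ≈ᴹ T′ →
      IsΘ P Q M T → IsΘ P′ Q′ M′ T′
    IsΘ-cong {P} {P′} {Q} {Q′} {M} {M′} {T} {T′} P≈ Q≈ M≈ T≈ θ i j k = begin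
      sumFin (λ l → M′ k l * (P′ l i * Q′ l j))
        ≈⟨ Σ-cong (λ l → *-cong (M≈ k l) (*-cong (P≈ l i) (Q≈ l j))) ⟨
      sumFin (λ l → M k l * (P l i * Q l j))
        ≈⟨ θ i j k ⟩
      T i j * (P k i * Q k j)
        ≈⟨ *-cong (T≈ i j) (*-cong (P≈ k i) (Q≈ k j)) ⟩
      T′ i j * (P′ k i * Q′ k j) ∎

    IsΘ-swap : ∀ {P Q M T : Mat n} → IsΘ P Q M T → IsΘ Q P M (T ᵀ)
    IsΘ-swap θ i j k =
      trans (Σ-cong (λ l → *-congˡ (*-comm _ _))) (trans (θ j i k) (*-congˡ (*-comm _ _)))

    IsΘ-+ : ∀ {P Q M M′ T T′ : Mat n} → IsΘ P Q M T → IsΘ P Q M′ T′ → IsΘ P Q (M +ᴹ M′) (T +ᴹ T′)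
    IsΘ-+ {P} {Q} {M} {M′} {T} {T′} θ θ′ i j k = begin
      sumFin (λ l → (M k l + M′ k l) * v l)                    ≈⟨ Σ-cong (λ l → distribʳ (v l) _ _) ⟩
      sumFin (λ l → M k l * v l + M′ k l * v l)                ≈⟨ Σ-+ _ _ ⟩
      sumFin (λ l → M k l * v l) + sumFin (λ l → M′ k l * v l) ≈⟨ +-cong (θ i j k) (θ′ i j k) ⟩
      T i j * v k + T′ i j * v k                               ≈⟨ distribʳ (v k) _ _ ⟨
      (T i j + T′ i j) * v k                                   ∎
      where
      v : Fin n → Carrier
      v = vec P Q i j

    IsΘ-double : ∀ {P Q M T : Mat n} → IsΘ P Q M T → IsΘ P Q (double M) (double T)
    IsΘ-double θ = IsΘ-+ θ θ

    IsΘ-· : ∀ {P Q M M′ T T′ : Mat n} → IsΘ P Q M T → IsΘ P Q M′ T′ → IsΘ P Q (M · M′) (T ∘ˢ T′)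
    IsΘ-· {P} {Q} {M} {M′} {T} {T′} θ θ′ i j k = begin
      sumFin (λ l → sumFin (λ q → M k q * M′ q l) * v l)
        ≈⟨ Σ-cong (λ l → trans (sym (Σ-*ʳ (v l) _)) (Σ-cong (λ q → *-assoc _ _ _))) ⟩
      sumFin (λ l → sumFin (λ q → M k q * (M′ q l * v l)))
        ≈⟨ Σ-swap _ ⟩
      sumFin (λ q → sumFin (λ l → M k q * (M′ q l * v l)))
        ≈⟨ Σ-cong (λ q → trans (Σ-*ˡ (M k q) _) (*-congˡ (θ′ i j q))) ⟩
      sumFin (λ q → M k q * (T′ i j * v q))
        ≈⟨ trans (Σ-cong (λ q → x∙yz≈y∙xz _ _ _)) (Σ-*ˡ _ _) ⟩
      T′ i j * sumFin (λ q → M k q * v q)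
        ≈⟨ *-congˡ (θ i j k) ⟩
      T′ i j * (T i j * v k)
        ≈⟨ trans (x∙yz≈y∙xz _ _ _) (sym (*-assoc _ _ _)) ⟩
      (T i j * T′ i j) * v k ∎
      where
      v : Fin n → Carrier
      v = vec P Q i j

    -- The exchange lemma: Q Q′ᵀ = n I makes the families Q eᵢ and Q′ eⱼ dual, so the
    -- eigenvalue matrix of a Schur product is the product of the eigenvalue matrices.
    IsΘ-∘ˢ : ∀ {P Q Q′ R M M′ T T′ : Mat n} → SchurInverses Q Q′ → (Q · (Q′ ᵀ)) ≈ᴹ nI n →
      IsΘ P Q M T → IsΘ Q′ R M′ T′ → IsΘ P R (N ⊙ (M ∘ˢ M′)) (T · T′)
    IsΘ-∘ˢ {P} {Q} {Q′} {R} {M} {M′} {T} {T′} QQ′≈1 QQ′ᵀ≈nI θ θ′ i k x = sym (begin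
      sumFin (λ j → T i j * T′ j k) * (P x i * R x k)
        ≈⟨ Σ-*ʳ _ _ ⟨
      sumFin (λ j → (T i j * T′ j k) * (P x i * R x k))
        ≈⟨ Σ-cong split ⟩
      sumFin (λ j → (T i j * (P x i * Q x j)) * (T′ j k * (Q′ x j * R x k)))
        ≈⟨ Σ-cong (λ j → *-cong (θ i j x) (θ′ j k x)) ⟨
      sumFin (λ j → sumFin (λ y → M x y * (P y i * Q y j)) * sumFin (λ z → M′ x z * (Q′ z j * R z k)))
        ≈⟨ Σ-cong (λ j → Σ-*-Σ _ _) ⟩
      sumFin (λ j → sumFin (λ y → sumFin (λ z → (M x y * (P y i * Q y j)) * (M′ x z * (Q′ z j * R z k)))))
        ≈⟨ trans (Σ-swap _) (Σ-cong (λ y → Σ-swap _)) ⟩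
      sumFin (λ y → sumFin (λ z → sumFin (λ j → (M x y * (P y i * Q y j)) * (M′ x z * (Q′ z j * R z k)))))
        ≈⟨ Σ-cong (λ y → Σ-cong (λ z → trans (Σ-cong (regroup y z)) (Σ-*ˡ _ _))) ⟩
      sumFin (λ y → sumFin (λ z → ((M x y * P y i) * (M′ x z * R z k)) * sumFin (λ j → Q y j * Q′ z j)))
        ≈⟨ Σ-cong (λ y → trans (Σ-cong (λ z → *-congˡ (QQ′ᵀ≈nI y z))) (Σ-nI′ _ y)) ⟩
      sumFin (λ y → N * ((M x y * P y i) * (M′ x y * R y k)))
        ≈⟨ Σ-cong (λ y → solve 5 (λ n a p b r → n :* ((a :* p) :* (b :* r)) := (n :* (a :* b)) :* (p :* r))
                                  refl N (M x y) (P y i) (M′ x y) (R y k)) ⟩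
      sumFin (λ y → (N * (M x y * M′ x y)) * (P y i * R y k)) ∎)
      where
      split : ∀ j → (T i j * T′ j k) * (P x i * R x k) ≈ (T i j * (P x i * Q x j)) * (T′ j k * (Q′ x j * R x k))
      split j = sym (trans
        (solve 6 (λ t t′ p r q q′ → (t :* (p :* q)) :* (t′ :* (q′ :* r)) := ((t :* t′) :* (p :* r)) :* (q :* q′))
               refl (T i j) (T′ j k) (P x i) (R x k) (Q x j) (Q′ x j))
        (*-identityʳ′ _ (QQ′≈1 x j)))
      regroup : ∀ y z j → (M x y * (P y i * Q y j)) * (M′ x z * (Q′ z j * R z k))
                        ≈ ((M x y * P y i) * (M′ x z * R z k)) * (Q y j * Q′ z j)
      regroup y z j =
        solve 6 (λ a p q b q′ r → (a :* (p :* q)) :* (b :* (q′ :* r)) := ((a :* p) :* (b :* r)) :* (q :* q′))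
                refl (M x y) (P y i) (Q y j) (M′ x z) (Q′ z j) (R z k)

    IsΘ⇒entry : ∀ {P Q Q′ M T : Mat n} → (Q · (Q′ ᵀ)) ≈ᴹ nI n → IsΘ P Q M T →
      ∀ i k q → N * (M k q * P q i) ≈ P k i * sumFin (λ j → T i j * (Q k j * Q′ q j))
    IsΘ⇒entry {P} {Q} {Q′} {M} {T} QQ′ᵀ≈nI θ i k q = sym (begin
      P k i * sumFin (λ j → T i j * (Q k j * Q′ q j))
        ≈⟨ Σ-*ˡ _ _ ⟨
      sumFin (λ j → P k i * (T i j * (Q k j * Q′ q j)))
        ≈⟨ Σ-cong (λ j → solve 4 (λ p t a b → p :* (t :* (a :* b)) := (t :* (p :* a)) :* b)
                                  refl (P k i) (T i j) (Q k j) (Q′ q j)) ⟩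
      sumFin (λ j → (T i j * (P k i * Q k j)) * Q′ q j)
        ≈⟨ Σ-cong (λ j → *-congʳ (θ i j k)) ⟨
      sumFin (λ j → sumFin (λ l → M k l * (P l i * Q l j)) * Q′ q j)
        ≈⟨ Σ-cong (λ j → Σ-*ʳ _ _) ⟨
      sumFin (λ j → sumFin (λ l → (M k l * (P l i * Q l j)) * Q′ q j))
        ≈⟨ Σ-swap _ ⟩
      sumFin (λ l → sumFin (λ j → (M k l * (P l i * Q l j)) * Q′ q j))
        ≈⟨ Σ-cong (λ l → trans (Σ-cong (λ j → solve 4 (λ a p b c → (a :* (p :* b)) :* c := (a :* p) :* (b :* c))
                                                          refl (M k l) (P l i) (Q l j) (Q′ q j)))
                               (Σ-*ˡ _ _)) ⟩
      sumFin (λ l → (M k l * P l i) * sumFin (λ j → Q l j * Q′ q j))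
        ≈⟨ Σ-cong (λ l → *-congˡ (QQ′ᵀ≈nI l q)) ⟩
      sumFin (λ l → (M k l * P l i) * nI n l q)
        ≈⟨ Σ-nI _ q ⟩
      N * (M k q * P q i) ∎)

    Θ-unique : ∀ {P Q M T T′ : Mat n} → NoZeroEntry P → NoZeroEntry Q →
      IsΘ P Q M T → IsΘ P Q M T′ → T ≈ᴹ T′
    Θ-unique P≉0 Q≉0 θ θ′ i j =
      *-cancelʳ (*-≉0 (P≉0 i i) (Q≉0 i j)) (trans (sym (θ i j i)) (θ′ i j i))

    module _ (N≉0 : ¬ N ≈ 0#) where

      IsΘ-ᵀ : ∀ {P P′ Q Q′ M T : Mat n} → SchurInverses P P′ →
        (Q · (Q′ ᵀ)) ≈ᴹ nI n → ((Q ᵀ) · Q′) ≈ᴹ nI n →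
        IsΘ P Q M T → IsΘ P′ Q′ (M ᵀ) T
      IsΘ-ᵀ {P} {P′} {Q} {Q′} {M} {T} PP′≈1 QQ′ᵀ≈nI QᵀQ′≈nI θ i j k = *-cancelˡ N≉0 (begin
        N * sumFin (λ l → M l k * (P′ l i * Q′ l j))
          ≈⟨ Σ-*ˡ N _ ⟨
        sumFin (λ l → N * (M l k * (P′ l i * Q′ l j)))
          ≈⟨ Σ-cong scaled ⟩
        sumFin (λ l → P′ k i * sumFin (λ j′ → (T i j′ * Q′ k j′) * (Q l j′ * Q′ l j)))
          ≈⟨ Σ-*ˡ _ _ ⟩
        P′ k i * sumFin (λ l → sumFin (λ j′ → (T i j′ * Q′ k j′) * (Q l j′ * Q′ l j)))
          ≈⟨ *-congˡ (Σ-swap _) ⟩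
        P′ k i * sumFin (λ j′ → sumFin (λ l → (T i j′ * Q′ k j′) * (Q l j′ * Q′ l j)))
          ≈⟨ *-congˡ (Σ-cong (λ j′ → trans (Σ-*ˡ _ _) (*-congˡ (QᵀQ′≈nI j′ j)))) ⟩
        P′ k i * sumFin (λ j′ → (T i j′ * Q′ k j′) * nI n j′ j)
          ≈⟨ *-congˡ (Σ-nI _ j) ⟩
        P′ k i * (N * (T i j * Q′ k j))
          ≈⟨ solve 4 (λ p n t q → p :* (n :* (t :* q)) := n :* (t :* (p :* q))) refl (P′ k i) N (T i j) (Q′ k j) ⟩
        N * (T i j * (P′ k i * Q′ k j)) ∎)
        where
        scaled : ∀ l → N * (M l k * (P′ l i * Q′ l j)) ≈
                       P′ k i * sumFin (λ j′ → (T i j′ * Q′ k j′) * (Q l j′ * Q′ l j))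
        scaled l = begin
          N * (M l k * (P′ l i * Q′ l j))
            ≈⟨ *-identityʳ′ _ (PP′≈1 k i) ⟨
          (N * (M l k * (P′ l i * Q′ l j))) * (P k i * P′ k i)
            ≈⟨ solve 6 (λ n a p p′ p₂ q → (n :* (a :* (p₂ :* q))) :* (p :* p′) := (n :* (a :* p)) :* (p′ :* (p₂ :* q)))
                       refl N (M l k) (P k i) (P′ k i) (P′ l i) (Q′ l j) ⟩
          (N * (M l k * P k i)) * (P′ k i * (P′ l i * Q′ l j))
            ≈⟨ *-congʳ (IsΘ⇒entry QQ′ᵀ≈nI θ i l k) ⟩
          (P l i * Σl) * (P′ k i * (P′ l i * Q′ l j))
            ≈⟨ solve 5 (λ p s p′ p₂ q → (p :* s) :* (p′ :* (p₂ :* q)) := (p′ :* (s :* q)) :* (p :* p₂))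
                       refl (P l i) Σl (P′ k i) (P′ l i) (Q′ l j) ⟩
          (P′ k i * (Σl * Q′ l j)) * (P l i * P′ l i)
            ≈⟨ *-identityʳ′ _ (PP′≈1 l i) ⟩
          P′ k i * (Σl * Q′ l j)
            ≈⟨ *-congˡ (trans (sym (Σ-*ʳ _ _)) (Σ-cong (λ j′ → solve 4
                 (λ t a b c → (t :* (a :* b)) :* c := (t :* b) :* (a :* c)) refl (T i j′) (Q l j′) (Q′ k j′) (Q′ l j)))) ⟩
          P′ k i * sumFin (λ j′ → (T i j′ * Q′ k j′) * (Q l j′ * Q′ l j)) ∎
          where
          Σl : Carrier
          Σl = sumFin (λ j′ → T i j′ * (Q l j′ * Q′ k j′))

      IsΘ-injective : ∀ {P Q Q′ M M′ T : Mat n} → NoZeroEntry P → (Q · (Q′ ᵀ)) ≈ᴹ nI n →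
        IsΘ P Q M T → IsΘ P Q M′ T → M ≈ᴹ M′
      IsΘ-injective {P} P≉0 QQ′ᵀ≈nI θ θ′ k q = *-cancelʳ (P≉0 q q) (*-cancelˡ N≉0
        (trans (IsΘ⇒entry QQ′ᵀ≈nI θ q k q) (sym (IsΘ⇒entry QQ′ᵀ≈nI θ′ q k q))))

    -- Type-II matrices from Jones pairs

    -- For Q′ = Q⁽⁻⁾ this says that Q and Qᵀ are type-II.
    record TypeIIPair (Q Q′ : Mat n) : Set ℓ where
      field
        schur : SchurInverses Q Q′
        rows  : (Q · (Q′ ᵀ)) ≈ᴹ nI n
        cols  : ((Q ᵀ) · Q′) ≈ᴹ nI n

      nonzeroˡ : NoZeroEntry Q
      nonzeroˡ i j = invertible⇒≉0 (schur i j)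

      nonzeroʳ : NoZeroEntry Q′
      nonzeroʳ i j = invertible⇒≉0 (trans (*-comm _ _) (schur i j))

    TypeIIPair-swap : ∀ {Q Q′ : Mat n} → TypeIIPair Q Q′ → TypeIIPair Q′ Q
    TypeIIPair-swap t = record
      { schur = λ i j → trans (*-comm _ _) (schur i j)
      ; rows  = λ y z → trans (Σ-cong (λ j → *-comm _ _)) (trans (rows z y) (*-congˡ (I-sym z y)))
      ; cols  = λ y z → trans (Σ-cong (λ l → *-comm _ _)) (trans (cols z y) (*-congˡ (I-sym z y)))
      }
      where open TypeIIPair t

    braid⇒IsΘ : ∀ {A C : Mat n} → (∀ X → (A · (C ∘ˢ (A · X))) ≈ᴹ (C ∘ˢ (A · (C ∘ˢ X)))) → IsΘ A C A C
    braid⇒IsΘ {A} {C} braid i j k = begin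
      sumFin (λ l → A k l * (A l i * C l j))
        ≈⟨ Σ-cong (λ l → *-congˡ (trans (*-comm _ _) (*-congˡ (sym (Σ-δ (A l) i))))) ⟩
      sumFin (λ l → A k l * (C l j * sumFin (λ q → A l q * I q i)))
        ≈⟨ braid (λ q _ → I q i) k j ⟩
      C k j * sumFin (λ l → A k l * (C l j * I l i))
        ≈⟨ *-congˡ (trans (Σ-cong (λ l → sym (*-assoc _ _ _))) (Σ-δ (λ l → A k l * C l j) i)) ⟩
      C k j * (A k i * C i j)
        ≈⟨ x∙yz≈z∙yx _ _ _ ⟩
      C i j * (A k i * C k j) ∎

    -- θ says A ∈ 𝒩_{A,C} with Θ_{A,C}(A) = C; for a Jones pair (A , B) both B and Bᵀ qualify.
    module TypeIIFromBraid {A A⁻¹ C : Mat n} (A·A⁻¹≈I : (A · A⁻¹) ≈ᴹ I) (A⁻¹·A≈I : (A⁻¹ · A) ≈ᴹ I)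
                    (θ : IsΘ A C A C) (C≉0 : NoZeroEntry C) where

      trace : Carrier
      trace = sumFin (λ k → A k k)

      diagonal-expansion : ∀ i j → A i i ≈ sumFin (λ k → (A⁻¹ i k * A k i) * C k j)
      diagonal-expansion i j = *-cancelˡ (C≉0 i j) (begin
        C i j * A i i
          ≈⟨ *-comm _ _ ⟩
        A i i * C i j
          ≈⟨ Σ-δ′ (λ l → A l i * C l j) i ⟨
        sumFin (λ l → (A l i * C l j) * I i l)
          ≈⟨ Σ-cong (λ l → trans (*-congʳ (A⁻¹·A≈I i l)) (*-comm _ _)) ⟨
        sumFin (λ l → sumFin (λ k → A⁻¹ i k * A k l) * (A l i * C l j))
          ≈⟨ Σ-cong (λ l → trans (sym (Σ-*ʳ _ _)) (Σ-cong (λ k → *-assoc _ _ _))) ⟩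
        sumFin (λ l → sumFin (λ k → A⁻¹ i k * (A k l * (A l i * C l j))))
          ≈⟨ Σ-swap _ ⟩
        sumFin (λ k → sumFin (λ l → A⁻¹ i k * (A k l * (A l i * C l j))))
          ≈⟨ Σ-cong (λ k → trans (Σ-*ˡ _ _) (*-congˡ (θ i j k))) ⟩
        sumFin (λ k → A⁻¹ i k * (C i j * (A k i * C k j)))
          ≈⟨ Σ-cong (λ k → trans (x∙yz≈y∙xz _ _ _) (*-congˡ (sym (*-assoc _ _ _)))) ⟩
        sumFin (λ k → C i j * ((A⁻¹ i k * A k i) * C k j))
          ≈⟨ Σ-*ˡ _ _ ⟩
        C i j * sumFin (λ k → (A⁻¹ i k * A k i) * C k j) ∎)

      column-sum : ∀ j → sumFin (λ k → C k j) ≈ trace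
      column-sum j = begin
        sumFin (λ k → C k j)
          ≈⟨ Σ-cong (λ k → trans (*-congʳ (trans (A·A⁻¹≈I k k) (I-diag k))) (*-identityˡ _)) ⟨
        sumFin (λ k → sumFin (λ i → A k i * A⁻¹ i k) * C k j)
          ≈⟨ Σ-cong (λ k → trans (sym (Σ-*ʳ _ _)) (Σ-cong (λ i → *-congʳ (*-comm _ _)))) ⟩
        sumFin (λ k → sumFin (λ i → (A⁻¹ i k * A k i) * C k j))
          ≈⟨ Σ-swap _ ⟩
        sumFin (λ i → sumFin (λ k → (A⁻¹ i k * A k i) * C k j))
          ≈⟨ Σ-cong (λ i → diagonal-expansion i j) ⟨
        trace ∎

      module WithRowSums (A≉0 : NoZeroEntry A) (row-sum : ∀ l → sumFin (λ j → C l j) ≈ trace) where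

        factorisation : ∀ k p j → A k p * C p j ≈ C k j * sumFin (λ l → (A k l * A⁻¹ l p) * C l j)
        factorisation k p j = begin
          A k p * C p j
            ≈⟨ Σ-δ (λ q → A k q * C q j) p ⟨
          sumFin (λ q → (A k q * C q j) * I q p)
            ≈⟨ Σ-cong (λ q → *-congˡ (A·A⁻¹≈I q p)) ⟨
          sumFin (λ q → (A k q * C q j) * sumFin (λ l → A q l * A⁻¹ l p))
            ≈⟨ Σ-cong (λ q → trans (sym (Σ-*ˡ _ _)) (Σ-cong (λ l → solve 4
                 (λ a c b d → (a :* c) :* (b :* d) := (a :* (b :* c)) :* d) refl (A k q) (C q j) (A q l) (A⁻¹ l p)))) ⟩
          sumFin (λ q → sumFin (λ l → (A k q * (A q l * C q j)) * A⁻¹ l p))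
            ≈⟨ Σ-swap _ ⟩
          sumFin (λ l → sumFin (λ q → (A k q * (A q l * C q j)) * A⁻¹ l p))
            ≈⟨ Σ-cong (λ l → trans (Σ-*ʳ _ _) (*-congʳ (θ l j k))) ⟩
          sumFin (λ l → (C l j * (A k l * C k j)) * A⁻¹ l p)
            ≈⟨ Σ-cong (λ l → solve 4 (λ c a c′ a′ → (c :* (a :* c′)) :* a′ := c′ :* ((a :* a′) :* c))
                                      refl (C l j) (A k l) (C k j) (A⁻¹ l p)) ⟩
          sumFin (λ l → C k j * ((A k l * A⁻¹ l p) * C l j))
            ≈⟨ Σ-*ˡ _ _ ⟩
          C k j * sumFin (λ l → (A k l * A⁻¹ l p) * C l j) ∎

        ratio-sum : ∀ k p → A k p * sumFin (λ j → C p j * C k j ⁻¹) ≈ trace * I k p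
        ratio-sum k p = begin
          A k p * sumFin (λ j → C p j * C k j ⁻¹)
            ≈⟨ Σ-*ˡ _ _ ⟨
          sumFin (λ j → A k p * (C p j * C k j ⁻¹))
            ≈⟨ Σ-cong (λ j → trans (sym (*-assoc _ _ _)) (*-congʳ (factorisation k p j))) ⟩
          sumFin (λ j → (C k j * S j) * C k j ⁻¹)
            ≈⟨ Σ-cong (λ j → trans (xy∙z≈y∙xz _ _ _) (*-identityʳ′ _ (⁻¹-inverse _ (C≉0 k j)))) ⟩
          sumFin S
            ≈⟨ Σ-swap _ ⟩
          sumFin (λ l → sumFin (λ j → (A k l * A⁻¹ l p) * C l j))
            ≈⟨ Σ-cong (λ l → trans (Σ-*ˡ _ _) (*-congˡ (row-sum l))) ⟩
          sumFin (λ l → (A k l * A⁻¹ l p) * trace)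
            ≈⟨ Σ-*ʳ _ _ ⟩
          (A · A⁻¹) k p * trace
            ≈⟨ trans (*-congʳ (A·A⁻¹≈I k p)) (*-comm _ _) ⟩
          trace * I k p ∎
          where
          S : Fin n → Carrier
          S j = sumFin (λ l → (A k l * A⁻¹ l p) * C l j)

        self-ratio-sum : ∀ k → sumFin (λ j → C k j * C k j ⁻¹) ≈ N
        self-ratio-sum k = trans (Σ-cong (λ j → ⁻¹-inverse _ (C≉0 k j))) (Σ-1 {n})

        typeII : (C · ((C ⁽⁻⁾) ᵀ)) ≈ᴹ nI n
        typeII p k with p Fin.≟ k
        ... | yes ≡.refl = trans (self-ratio-sum p) (sym (*-identityʳ N))
        ... | no p≢k     = *-cancelˡ (A≉0 k p) (begin
          A k p * sumFin (λ j → C p j * C k j ⁻¹) ≈⟨ ratio-sum k p ⟩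
          trace * I k p                          ≈⟨ *-congˡ (I-off (λ k≡p → p≢k (≡.sym k≡p))) ⟩
          trace * 0#                             ≈⟨ zeroʳ _ ⟩
          0#                                     ≈⟨ trans (*-congˡ (zeroʳ N)) (zeroʳ _) ⟨
          A k p * (N * 0#)                       ∎)

        diagonal-constant : ∀ k → A k k * N ≈ trace
        diagonal-constant k = begin
          A k k * N                                ≈⟨ *-congˡ (self-ratio-sum k) ⟨
          A k k * sumFin (λ j → C k j * C k j ⁻¹)  ≈⟨ ratio-sum k k ⟩
          trace * I k k                            ≈⟨ *-identityʳ′ trace (I-diag k) ⟩
          trace                                    ∎

    module _ (N≉0 : ¬ N ≈ 0#) where

      module JonesPairTypeII {A B A⁻¹ : Mat n} (A·A⁻¹≈I : (A · A⁻¹) ≈ᴹ I) (A⁻¹·A≈I : (A⁻¹ · A) ≈ᴹ I)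
        (A≉0 : NoZeroEntry A) (B≉0 : NoZeroEntry B)
        (braid  : ∀ X → (A · (B ∘ˢ (A · X))) ≈ᴹ (B ∘ˢ (A · (B ∘ˢ X))))
        (braidᵀ : ∀ X → (A · ((B ᵀ) ∘ˢ (A · X))) ≈ᴹ ((B ᵀ) ∘ˢ (A · ((B ᵀ) ∘ˢ X)))) where

        private
          Ā B̄ : Mat n
          Ā = A ⁽⁻⁾
          B̄ = B ⁽⁻⁾
          module B-braid  = TypeIIFromBraid A·A⁻¹≈I A⁻¹·A≈I (braid⇒IsΘ braid) B≉0
          module Bᵀ-braid = TypeIIFromBraid A·A⁻¹≈I A⁻¹·A≈I (braid⇒IsΘ braidᵀ) (λ i j → B≉0 j i)
          module B-rows   = B-braid.WithRowSums A≉0 Bᵀ-braid.column-sum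
          module Bᵀ-rows  = Bᵀ-braid.WithRowSums A≉0 B-braid.column-sum
          open B-braid using (trace)

        B-typeII : TypeIIPair B B̄
        B-typeII = record { schur = λ i j → ⁻¹-inverse _ (B≉0 i j) ; rows = B-rows.typeII ; cols = Bᵀ-rows.typeII }

        private
          θ : IsΘ Ā B̄ (A ᵀ) B
          θ = IsΘ-ᵀ N≉0 (λ i j → ⁻¹-inverse _ (A≉0 i j)) B-rows.typeII Bᵀ-rows.typeII (braid⇒IsΘ braid)

          B-weighted-sum : ∀ i k l → sumFin (λ j → B l j * (B i j * (Ā k i * B̄ k j))) ≈ N * (Ā l i * A l k)
          B-weighted-sum i k l = begin
            sumFin (λ j → B l j * (B i j * (Ā k i * B̄ k j)))
              ≈⟨ Σ-cong (λ j → *-congˡ (θ i j k)) ⟨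
            sumFin (λ j → B l j * sumFin (λ q → A q k * (Ā q i * B̄ q j)))
              ≈⟨ Σ-cong (λ j → Σ-*ˡ _ _) ⟨
            sumFin (λ j → sumFin (λ q → B l j * (A q k * (Ā q i * B̄ q j))))
              ≈⟨ Σ-swap _ ⟩
            sumFin (λ q → sumFin (λ j → B l j * (A q k * (Ā q i * B̄ q j))))
              ≈⟨ Σ-cong (λ q → trans (Σ-cong (λ j → solve 4
                   (λ b a a′ b′ → b :* (a :* (a′ :* b′)) := (a′ :* a) :* (b :* b′)) refl (B l j) (A q k) (Ā q i) (B̄ q j)))
                   (Σ-*ˡ _ _)) ⟩
            sumFin (λ q → (Ā q i * A q k) * sumFin (λ j → B l j * B̄ q j))
              ≈⟨ Σ-cong (λ q → *-congˡ (B-rows.typeII l q)) ⟩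
            sumFin (λ q → (Ā q i * A q k) * nI n l q)
              ≈⟨ Σ-nI′ _ l ⟩
            N * (Ā l i * A l k) ∎

          trace*Ā≈N : ∀ i → trace * Ā i i ≈ N
          trace*Ā≈N i = begin
            trace * Ā i i        ≈⟨ *-congʳ (B-rows.diagonal-constant i) ⟨
            (A i i * N) * Ā i i  ≈⟨ xy∙z≈y∙xz _ _ _ ⟩
            N * (A i i * Ā i i)  ≈⟨ *-identityʳ′ N (⁻¹-inverse _ (A≉0 i i)) ⟩
            N                    ∎

          trace*Ā*I≈nI : ∀ i k → (trace * Ā k i) * I i k ≈ N * I i k
          trace*Ā*I≈nI i k with i Fin.≟ k
          ... | yes ≡.refl = *-congʳ (trace*Ā≈N i)
          ... | no _       = trans (zeroʳ _) (sym (zeroʳ N))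

        Āᵀ·A≈nI : ((Ā ᵀ) · A) ≈ᴹ nI n
        Āᵀ·A≈nI i k = *-cancelˡ N≉0 (begin
          N * sumFin (λ l → Ā l i * A l k)
            ≈⟨ Σ-*ˡ N _ ⟨
          sumFin (λ l → N * (Ā l i * A l k))
            ≈⟨ Σ-cong (B-weighted-sum i k) ⟨
          sumFin (λ l → sumFin (λ j → B l j * (B i j * (Ā k i * B̄ k j))))
            ≈⟨ Σ-swap _ ⟩
          sumFin (λ j → sumFin (λ l → B l j * (B i j * (Ā k i * B̄ k j))))
            ≈⟨ Σ-cong (λ j → trans (Σ-*ʳ _ _) (*-congʳ (B-braid.column-sum j))) ⟩
          sumFin (λ j → trace * (B i j * (Ā k i * B̄ k j)))
            ≈⟨ Σ-cong (λ j → solve 4 (λ t b a′ b′ → t :* (b :* (a′ :* b′)) := (t :* a′) :* (b :* b′))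
                                      refl trace (B i j) (Ā k i) (B̄ k j)) ⟩
          sumFin (λ j → (trace * Ā k i) * (B i j * B̄ k j))
            ≈⟨ Σ-*ˡ _ _ ⟩
          (trace * Ā k i) * sumFin (λ j → B i j * B̄ k j)
            ≈⟨ *-congˡ (B-rows.typeII i k) ⟩
          (trace * Ā k i) * (N * I i k)
            ≈⟨ x∙yz≈y∙xz _ _ _ ⟩
          N * ((trace * Ā k i) * I i k)
            ≈⟨ *-congˡ (trace*Ā*I≈nI i k) ⟩
          N * (N * I i k) ∎)

        symmetric⇒A-typeII : Symmetric A → TypeIIPair A Ā
        symmetric⇒A-typeII A≈Aᵀ = TypeIIPair-swap (record
          { schur = λ i j → ⁻¹-inverseˡ (A≉0 i j)
          ; rows  = λ y z → trans (Σ-cong (λ j → *-cong (Ā-sym y j) (A≈Aᵀ z j))) (Āᵀ·A≈nI y z)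
          ; cols  = Āᵀ·A≈nI
          })
          where
          Ā-sym : ∀ i j → Ā i j ≈ Ā j i
          Ā-sym i j = ⁻¹-unique (trans (*-congʳ (sym (A≈Aᵀ i j))) (⁻¹-inverse _ (A≉0 i j)))

      invertibleJonesPair⇒B-typeII : ∀ {A B : Mat n} → InvertibleJonesPair A B → TypeIIPair B (B ⁽⁻⁾)
      invertibleJonesPair⇒B-typeII (((_ , A·A⁻¹≈I , A⁻¹·A≈I) , B≉0 , braid , braidᵀ) , A≉0 , _) =
        JonesPairTypeII.B-typeII A·A⁻¹≈I A⁻¹·A≈I A≉0 B≉0 braid braidᵀ

      invertibleJonesPair⇒A-typeII : ∀ {A B : Mat n} → InvertibleJonesPair A B → Symmetric A →
        TypeIIPair A (A ⁽⁻⁾)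
      invertibleJonesPair⇒A-typeII (((_ , A·A⁻¹≈I , A⁻¹·A≈I) , B≉0 , braid , braidᵀ) , A≉0 , _) =
        JonesPairTypeII.symmetric⇒A-typeII A·A⁻¹≈I A⁻¹·A≈I A≉0 B≉0 braid braidᵀ

    -- Closure and commutativity of 𝓑

    module Closure (N≉0 : ¬ N ≈ 0#) {A B : Mat n}
                   (A-typeII : TypeIIPair A (A ⁽⁻⁾)) (B-typeII : TypeIIPair B (B ⁽⁻⁾)) where

      private
        Ā B̄ : Mat n
        Ā = A ⁽⁻⁾
        B̄ = B ⁽⁻⁾
        Ā-typeII : TypeIIPair Ā A
        Ā-typeII = TypeIIPair-swap A-typeII

        B̄-typeII : TypeIIPair B̄ B
        B̄-typeII = TypeIIPair-swap B-typeII

        open TypeIIPair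

        B̄⁽⁻⁾≈B : (B̄ ⁽⁻⁾) ≈ᴹ B
        B̄⁽⁻⁾≈B i j = sym (⁻¹-unique (schur B̄-typeII i j))

        exchangeᴬ : ∀ {P R M M′ T T′} → IsΘ P Ā M T → IsΘ A R M′ T′ → IsΘ P R (N ⊙ (M ∘ˢ M′)) (T · T′)
        exchangeᴬ = IsΘ-∘ˢ (schur Ā-typeII) (rows Ā-typeII)

        exchangeᴮ : ∀ {P R M M′ T T′} → IsΘ P B M T → IsΘ B̄ R M′ T′ → IsΘ P R (N ⊙ (M ∘ˢ M′)) (T · T′)
        exchangeᴮ = IsΘ-∘ˢ (schur B-typeII) (rows B-typeII)

      module _ (d : 𝓜-data A B) where

        F∈𝒩[B̄,B] : IsΘ B̄ B (F d) (ΘBF d)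
        F∈𝒩[B̄,B] = IsΘ-cong ≈ᴹ-refl B̄⁽⁻⁾≈B ≈ᴹ-refl ≈ᴹ-refl (F∈𝒩B⁻ d)

        Fᵀ∈𝒩[A,Ā] : IsΘ A Ā (F d ᵀ) (ΘAF d ᵀ)
        Fᵀ∈𝒩[A,Ā] = IsΘ-swap (IsΘ-ᵀ N≉0 (schur A-typeII) (rows Ā-typeII) (cols Ā-typeII) (F∈𝒩A d))

        Fᵀ∈𝒩[B̄,B] : IsΘ B̄ B (F d ᵀ) (ΘBF d ᵀ)
        Fᵀ∈𝒩[B̄,B] = IsΘ-swap (IsΘ-ᵀ N≉0 (schur B̄-typeII) (rows B-typeII) (cols B-typeII) F∈𝒩[B̄,B])

        G∈𝒩[B̄,Ā] : IsΘ B̄ Ā (G d) (ΘGt d ᵀ)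
        G∈𝒩[B̄,Ā] = IsΘ-swap (IsΘ-ᵀ N≉0 (schur A-typeII) (rows B-typeII) (cols B-typeII) (Gᵀ∈𝒩AB d))

      product : 𝓜-data A B → 𝓜-data A B → 𝓜-data A B
      product d d′ = record
        { F   = double ((N ⊙ (F d ∘ˢ F d′)) +ᴹ (N ⊙ (G d ∘ˢ G d′)))
        ; G   = double ((N ⊙ (F d ∘ˢ G d′)) +ᴹ (N ⊙ (G d ∘ˢ F d′)))
        ; H   = double (H d · H d′)
        ; K   = double (K d · K d′)
        ; ΘAF = double ((ΘAF d · ΘAF d′) +ᴹ (ΘG d · (ΘGt d′ ᵀ)))
        ; ΘBF = double ((ΘBF d · ΘBF d′) +ᴹ ((ΘGt d ᵀ) · ΘG d′))
        ; ΘG  = double ((ΘAF d · ΘG d′) +ᴹ (ΘG d · ΘBF d′))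
        ; ΘGt = double ((ΘGt d′ · (ΘBF d ᵀ)) +ᴹ ((ΘAF d′ ᵀ) · ΘGt d))
        ; ΘH  = double (ΘH d ∘ˢ ΘH d′)
        ; F∈𝒩A = IsΘ-double (IsΘ-+ (exchangeᴬ (F∈𝒩A d) (F∈𝒩A d′)) (exchangeᴮ (G∈𝒩AB d) (G∈𝒩[B̄,Ā] d′)))
        ; F∈𝒩B⁻ = IsΘ-cong ≈ᴹ-refl (λ i j → sym (B̄⁽⁻⁾≈B i j)) ≈ᴹ-refl ≈ᴹ-refl
            (IsΘ-double (IsΘ-+ (exchangeᴮ (F∈𝒩[B̄,B] d) (F∈𝒩[B̄,B] d′)) (exchangeᴬ (G∈𝒩[B̄,Ā] d) (G∈𝒩AB d′))))
        ; G∈𝒩AB = IsΘ-double (IsΘ-+ (exchangeᴬ (F∈𝒩A d) (G∈𝒩AB d′)) (exchangeᴮ (G∈𝒩AB d) (F∈𝒩[B̄,B] d′)))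
        ; Gᵀ∈𝒩AB = IsΘ-cong ≈ᴹ-refl ≈ᴹ-refl (double-cong (λ i j → +-cong (*-congˡ (*-comm _ _)) (*-congˡ (*-comm _ _)))) ≈ᴹ-refl
            (IsΘ-double (IsΘ-+ (exchangeᴮ (Gᵀ∈𝒩AB d′) (Fᵀ∈𝒩[B̄,B] d)) (exchangeᴬ (Fᵀ∈𝒩[A,Ā] d′) (Gᵀ∈𝒩AB d))))
        ; H∈𝒩AB = IsΘ-double (IsΘ-· (H∈𝒩AB d) (H∈𝒩AB d′))
        ; K-paired = IsΘ-cong ≈ᴹ-refl ≈ᴹ-refl (double-cong (λ i j → Σ-cong (λ k → *-comm _ _)))
            (double-cong (λ i j → *-comm _ _)) (IsΘ-double (IsΘ-· (K-paired d′) (K-paired d)))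
        }

      𝓜-· : ∀ d d′ → (𝓜 d ·ᴮ 𝓜 d′) ≈ᴮ 𝓜 (product d d′)
      𝓜-· d d′ = blocks-·

      𝓜-product-comm : ∀ d d′ → 𝓜 (product d d′) ≈ᴮ 𝓜 (product d′ d)
      𝓜-product-comm d d′ = blocks-cong ΘAF≈ ΘBF≈ ΘG≈ ΘGt≈ H≈ (λ i j → Kᵀ≈ j i)
        where
        dd′ d′d : 𝓜-data A B
        dd′ = product d d′
        d′d = product d′ d

        F≈ : F d′d ≈ᴹ F dd′
        F≈ = double-cong (λ i j → +-cong (*-congˡ (*-comm _ _)) (*-congˡ (*-comm _ _)))

        G≈ : G d′d ≈ᴹ G dd′
        G≈ = double-cong (λ i j → trans (+-comm _ _) (+-cong (*-congˡ (*-comm _ _)) (*-congˡ (*-comm _ _))))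

        ΘH≈ : ΘH d′d ≈ᴹ ΘH dd′
        ΘH≈ = double-cong (λ i j → *-comm _ _)

        ΘAF≈ : ΘAF dd′ ≈ᴹ ΘAF d′d
        ΘAF≈ = Θ-unique (nonzeroˡ A-typeII) (nonzeroʳ A-typeII)
          (F∈𝒩A dd′) (IsΘ-cong ≈ᴹ-refl ≈ᴹ-refl F≈ ≈ᴹ-refl (F∈𝒩A d′d))

        ΘBF≈ : ΘBF dd′ ≈ᴹ ΘBF d′d
        ΘBF≈ = Θ-unique (nonzeroʳ B-typeII) (nonzeroˡ B-typeII)
          (F∈𝒩[B̄,B] dd′) (IsΘ-cong ≈ᴹ-refl ≈ᴹ-refl F≈ ≈ᴹ-refl (F∈𝒩[B̄,B] d′d))

        ΘG≈ : ΘG dd′ ≈ᴹ ΘG d′d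
        ΘG≈ = Θ-unique (nonzeroˡ A-typeII) (nonzeroˡ B-typeII)
          (G∈𝒩AB dd′) (IsΘ-cong ≈ᴹ-refl ≈ᴹ-refl G≈ ≈ᴹ-refl (G∈𝒩AB d′d))

        ΘGt≈ : ΘGt dd′ ≈ᴹ ΘGt d′d
        ΘGt≈ = Θ-unique (nonzeroˡ A-typeII) (nonzeroˡ B-typeII)
          (Gᵀ∈𝒩AB dd′) (IsΘ-cong ≈ᴹ-refl ≈ᴹ-refl (λ i j → G≈ j i) ≈ᴹ-refl (Gᵀ∈𝒩AB d′d))

        H≈ : H dd′ ≈ᴹ H d′d
        H≈ = IsΘ-injective N≉0 (nonzeroˡ A-typeII) (rows B-typeII)
          (H∈𝒩AB dd′) (IsΘ-cong ≈ᴹ-refl ≈ᴹ-refl ≈ᴹ-refl ΘH≈ (H∈𝒩AB d′d))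

        Kᵀ≈ : (K dd′ ᵀ) ≈ᴹ (K d′d ᵀ)
        Kᵀ≈ = IsΘ-injective N≉0 (nonzeroˡ A-typeII) (cols B-typeII)
          (K-paired dd′) (IsΘ-cong ≈ᴹ-refl ≈ᴹ-refl ≈ᴹ-refl (λ i j → ΘH≈ j i) (K-paired d′d))

      ∈𝓑-·-closed : ∀ {X Y} → X ∈𝓑[ A , B ] → Y ∈𝓑[ A , B ] → (X ·ᴮ Y) ∈𝓑[ A , B ]
      ∈𝓑-·-closed (d , X≈) (d′ , Y≈) = product d d′ , λ p q i j →
        trans (·ᴮ-cong X≈ Y≈ p q i j) (𝓜-· d d′ p q i j)

      ∈𝓑-·-comm : ∀ {X Y} → X ∈𝓑[ A , B ] → Y ∈𝓑[ A , B ] → (X ·ᴮ Y) ≈ᴮ (Y ·ᴮ X)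
      ∈𝓑-·-comm {X} {Y} (d , X≈) (d′ , Y≈) p q i j = begin
        (X ·ᴮ Y) p q i j                ≈⟨ ·ᴮ-cong X≈ Y≈ p q i j ⟩
        (𝓜 d ·ᴮ 𝓜 d′) p q i j           ≈⟨ 𝓜-· d d′ p q i j ⟩
        𝓜 (product d d′) p q i j        ≈⟨ 𝓜-product-comm d d′ p q i j ⟩
        𝓜 (product d′ d) p q i j        ≈⟨ 𝓜-· d′ d p q i j ⟨
        (𝓜 d′ ·ᴮ 𝓜 d) p q i j           ≈⟨ ·ᴮ-cong Y≈ X≈ p q i j ⟨
        (Y ·ᴮ X) p q i j                ∎

lemma6p5 : ∀ {c ℓ} (𝔽 : ACField0 c ℓ) (n : ℕ) →
    let open Matrices 𝔽 in
    (A B : Mat n) → InvertibleJonesPair A B → Symmetric A →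
    ∀ (X Y : BMat n) → X ∈𝓑[ A , B ] → Y ∈𝓑[ A , B ] →
    ((X ·ᴮ Y) ∈𝓑[ A , B ]) × ((X ·ᴮ Y) ≈ᴮ (Y ·ᴮ X))
lemma6p5 𝔽 zero    A B _  _    X Y (d , _) _ = (d , λ _ _ ()) , (λ _ _ ())
lemma6p5 𝔽 (suc m) A B jp A≈Aᵀ X Y X∈𝓑 Y∈𝓑 = ∈𝓑-·-closed X∈𝓑 Y∈𝓑 , ∈𝓑-·-comm X∈𝓑 Y∈𝓑
  where
  open ACField0 𝔽 using (char0)
  open JonesPairAlgebra 𝔽
  open Closure (char0 m) (invertibleJonesPair⇒A-typeII (char0 m) jp A≈Aᵀ)
                         (invertibleJonesPair⇒B-typeII (char0 m) jp)
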